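{- A map $f: A\to B$ in a dagger category $(\mathbb{X},\dagger)$ is Moore-Penrose split if and only if there exist $\dagger$-idempotents $e_1: A\to A$ and $e_2: B\to B$, both of which $\dagger$-split, such that $f: (A,e_1)\to(B,e_2)$ is an isomorphism in $(\mathsf{Split}_\dagger(\mathbb{X}),\dagger)$.
   Context: Composition is in diagrammatic order. A dagger category is a category with an identity-on-objects contravariant involutive functor $\dagger$. A Moore-Penrose inverse of $f: A\to B$ is $f^\circ: B\to A$ with $ff^\circ f = f$, $f^\circ f f^\circ = f^\circ$, $(ff^\circ)^\dagger = ff^\circ$, $(f^\circ f)^\dagger = f^\circ f$. A $\dagger$-idempotent is $e: A\to A$ with $ee = e = e^\dagger$; it $\dagger$-splits if $e = rr^\dagger$ for some $r: A\to X$ with $r^\dagger r = 1_X$. $f$ is Moore-Penrose split if it has a Moore-Penrose inverse $f^\circ$ and $ff^\circ$, $f^\circ f$ both $\dagger$-split. $\mathsf{Split}_\dagger(\mathbb{X})$ has objects pairs $(A,e)$ with $e$ a $\dagger$-idempotent on $A$; maps $f: (A_1,e_1)\to(A_2,e_2)$ are maps $f: A_1\to A_2$ with $e_1 f e_2 = f$; composition and dagger are as in $\mathbb{X}$, identity on $(A,e)$ is $e$. -}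

module Defs where

open import Level using (Level; suc; _⊔_)
open import Relation.Binary using (IsEquivalence)
open import Data.Product using (Σ; _×_; _,_; ∃)

-- Composition is written in diagrammatic order:
-- f ∘ g  means "first f, then g" (f : A ⇒ B, g : B ⇒ C, f ∘ g : A ⇒ C).
record DaggerCategory (o ℓ e : Level) : Set (suc (o ⊔ ℓ ⊔ e)) where
  infixr 9 _∘_
  infix 4 _≈_
  field
    Obj  : Set o
    _⇒_  : Obj → Obj → Set ℓ
    _≈_  : ∀ {A B} → A ⇒ B → A ⇒ B → Set e
    id   : ∀ {A} → A ⇒ A
    _∘_  : ∀ {A B C} → A ⇒ B → B ⇒ C → A ⇒ C
    ≈-equiv : ∀ {A B} → IsEquivalence (_≈_ {A} {B})
    ∘-resp-≈ : ∀ {A B C} {f f' : A ⇒ B} {g g' : B ⇒ C} →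
               f ≈ f' → g ≈ g' → f ∘ g ≈ f' ∘ g'
    assoc    : ∀ {A B C D} {f : A ⇒ B} {g : B ⇒ C} {h : C ⇒ D} →
               (f ∘ g) ∘ h ≈ f ∘ (g ∘ h)
    identityˡ : ∀ {A B} {f : A ⇒ B} → id ∘ f ≈ f
    identityʳ : ∀ {A B} {f : A ⇒ B} → f ∘ id ≈ f
    _†       : ∀ {A B} → A ⇒ B → B ⇒ A
    †-resp-≈ : ∀ {A B} {f g : A ⇒ B} → f ≈ g → f † ≈ g †
    †-id     : ∀ {A} → (id {A}) † ≈ id
    †-∘      : ∀ {A B C} {f : A ⇒ B} {g : B ⇒ C} → (f ∘ g) † ≈ g † ∘ f †
    †-invol  : ∀ {A B} {f : A ⇒ B} → (f †) † ≈ f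

module _ {o ℓ e : Level} (𝕏 : DaggerCategory o ℓ e) where
  open DaggerCategory 𝕏

  IsMPInverse : ∀ {A B} → A ⇒ B → B ⇒ A → Set e
  IsMPInverse f f° =
    (f ∘ f° ∘ f ≈ f) × (f° ∘ f ∘ f° ≈ f°) ×
    ((f ∘ f°) † ≈ f ∘ f°) × ((f° ∘ f) † ≈ f° ∘ f)

  IsDaggerIdempotent : ∀ {A} → A ⇒ A → Set e
  IsDaggerIdempotent e' = (e' ∘ e' ≈ e') × (e' † ≈ e')

  DaggerSplits : ∀ {A} → A ⇒ A → Set (o ⊔ ℓ ⊔ e)
  DaggerSplits {A} e' = Σ Obj λ X → Σ (A ⇒ X) λ r → (e' ≈ r ∘ r †) × (r † ∘ r ≈ id {X})

  MPSplit : ∀ {A B} → A ⇒ B → Set (o ⊔ ℓ ⊔ e)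
  MPSplit {A} {B} f = Σ (B ⇒ A) λ f° →
    IsMPInverse f f° × DaggerSplits (f ∘ f°) × DaggerSplits (f° ∘ f)

  -- Split_†(𝕏): maps (A,e₁) → (B,e₂) are maps f : A ⇒ B with e₁ f e₂ = f;
  -- composition as in 𝕏, identity on (A,e) is e.
  IsSplitMap : ∀ {A B} → A ⇒ A → B ⇒ B → A ⇒ B → Set e
  IsSplitMap e₁ e₂ f = e₁ ∘ f ∘ e₂ ≈ f

  IsSplitIso : ∀ {A B} → A ⇒ A → B ⇒ B → A ⇒ B → Set (ℓ ⊔ e)
  IsSplitIso {A} {B} e₁ e₂ f =
    IsSplitMap e₁ e₂ f ×
    Σ (B ⇒ A) λ g → IsSplitMap e₂ e₁ g × (f ∘ g ≈ e₁) × (g ∘ f ≈ e₂)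

{-# OPTIONS --safe #-}
module Submission where

open import Defs
open import Level using (Level; _⊔_)
open import Data.Product using (Σ; _×_; _,_)
open import Function.Bundles using (_⇔_; mk⇔)
open import Relation.Binary.Bundles using (Setoid)
import Relation.Binary.Reasoning.Setoid as SetoidReasoning

-- For a Moore-Penrose inverse f°, take e₁ = f f° and e₂ = f° f: the four
-- Moore-Penrose equations say exactly that these are †-idempotents and that
-- f and f° are mutually inverse maps between (A, e₁) and (B, e₂).
-- Conversely an inverse g of f in Split_† is a Moore-Penrose inverse: f g f = e₁ f = f
-- since a map out of (A, e₁) absorbs e₁, and f g = e₁ is self-adjoint.

module _ {o ℓ e : Level} (𝕏 : DaggerCategory o ℓ e) where
  open DaggerCategory 𝕏

  homSetoid : Obj → Obj → Setoid ℓ e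
  homSetoid A B = record { isEquivalence = ≈-equiv {A} {B} }

  private
    module _ {A B : Obj} where
      open Setoid (homSetoid A B) public using (refl; sym; trans)

    module HomReasoning {A B : Obj} = SetoidReasoning (homSetoid A B)

  IsMPInverse-sym : ∀ {A B} {f : A ⇒ B} {f° : B ⇒ A} →
                    IsMPInverse 𝕏 f f° → IsMPInverse 𝕏 f° f
  IsMPInverse-sym (ff°f , f°ff° , ff°-sa , f°f-sa) = f°ff° , ff°f , f°f-sa , ff°-sa

  absorb⇒idempotent : ∀ {A B} {f : A ⇒ B} {g : B ⇒ A} →
                      g ∘ f ∘ g ≈ g → (f ∘ g) ∘ (f ∘ g) ≈ f ∘ g
  absorb⇒idempotent gfg = trans assoc (∘-resp-≈ refl gfg)

  MPInverse⇒isDaggerIdempotent : ∀ {A B} {f : A ⇒ B} {f° : B ⇒ A} →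
                                 IsMPInverse 𝕏 f f° → IsDaggerIdempotent 𝕏 (f ∘ f°)
  MPInverse⇒isDaggerIdempotent (_ , f°ff° , ff°-sa , _) = absorb⇒idempotent f°ff° , ff°-sa

  MPInverse⇒isSplitMap : ∀ {A B} {f : A ⇒ B} {f° : B ⇒ A} →
                         IsMPInverse 𝕏 f f° → IsSplitMap 𝕏 (f ∘ f°) (f° ∘ f) f
  MPInverse⇒isSplitMap {f = f} {f°} (ff°f , _) = begin
    (f ∘ f°) ∘ f ∘ f° ∘ f ≈⟨ assoc ⟩
    f ∘ f° ∘ f ∘ f° ∘ f   ≈⟨ ∘-resp-≈ refl (∘-resp-≈ refl ff°f) ⟩
    f ∘ f° ∘ f            ≈⟨ ff°f ⟩
    f                     ∎
    where open HomReasoning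

  MPInverse⇒isSplitIso : ∀ {A B} {f : A ⇒ B} {f° : B ⇒ A} →
                         IsMPInverse 𝕏 f f° → IsSplitIso 𝕏 (f ∘ f°) (f° ∘ f) f
  MPInverse⇒isSplitIso mp =
    MPInverse⇒isSplitMap mp , _ , MPInverse⇒isSplitMap (IsMPInverse-sym mp) , refl , refl

  isSplitMap⇒absorbˡ : ∀ {A B} {e₁ : A ⇒ A} {e₂ : B ⇒ B} {h : A ⇒ B} →
                       e₁ ∘ e₁ ≈ e₁ → IsSplitMap 𝕏 e₁ e₂ h → e₁ ∘ h ≈ h
  isSplitMap⇒absorbˡ {e₁ = e₁} {e₂} {h} e₁e₁ e₁he₂ = begin
    e₁ ∘ h               ≈⟨ ∘-resp-≈ refl (sym e₁he₂) ⟩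
    e₁ ∘ e₁ ∘ h ∘ e₂     ≈⟨ sym assoc ⟩
    (e₁ ∘ e₁) ∘ h ∘ e₂   ≈⟨ ∘-resp-≈ e₁e₁ refl ⟩
    e₁ ∘ h ∘ e₂          ≈⟨ e₁he₂ ⟩
    h                    ∎
    where open HomReasoning

  splitInverse⇒fgf≈f : ∀ {A B} {e₁ : A ⇒ A} {e₂ : B ⇒ B} {f : A ⇒ B} {g : B ⇒ A} →
                       e₁ ∘ e₁ ≈ e₁ → IsSplitMap 𝕏 e₁ e₂ f → f ∘ g ≈ e₁ → f ∘ g ∘ f ≈ f
  splitInverse⇒fgf≈f {e₁ = e₁} {f = f} {g} e₁e₁ f-map fg = begin
    f ∘ g ∘ f     ≈⟨ sym assoc ⟩
    (f ∘ g) ∘ f   ≈⟨ ∘-resp-≈ fg refl ⟩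
    e₁ ∘ f        ≈⟨ isSplitMap⇒absorbˡ e₁e₁ f-map ⟩
    f             ∎
    where open HomReasoning

  selfAdjoint-resp-≈ : ∀ {A} {x y : A ⇒ A} → x ≈ y → y † ≈ y → x † ≈ x
  selfAdjoint-resp-≈ x≈y y-sa = trans (†-resp-≈ x≈y) (trans y-sa (sym x≈y))

  DaggerSplits-resp-≈ : ∀ {A} {x y : A ⇒ A} → x ≈ y → DaggerSplits 𝕏 y → DaggerSplits 𝕏 x
  DaggerSplits-resp-≈ x≈y (X , r , y≈rr† , r†r) = X , r , trans x≈y y≈rr† , r†r

  isSplitIso⇒MPInverse : ∀ {A B} {e₁ : A ⇒ A} {e₂ : B ⇒ B} {f : A ⇒ B} {g : B ⇒ A} →
                         IsDaggerIdempotent 𝕏 e₁ → IsDaggerIdempotent 𝕏 e₂ →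
                         IsSplitMap 𝕏 e₁ e₂ f → IsSplitMap 𝕏 e₂ e₁ g →
                         f ∘ g ≈ e₁ → g ∘ f ≈ e₂ → IsMPInverse 𝕏 f g
  isSplitIso⇒MPInverse (e₁e₁ , e₁-sa) (e₂e₂ , e₂-sa) f-map g-map fg gf =
    splitInverse⇒fgf≈f e₁e₁ f-map fg , splitInverse⇒fgf≈f e₂e₂ g-map gf ,
    selfAdjoint-resp-≈ fg e₁-sa , selfAdjoint-resp-≈ gf e₂-sa

  IsDaggerSplitIso : ∀ {A B} → A ⇒ B → Set (o ⊔ ℓ ⊔ e)
  IsDaggerSplitIso {A} {B} f = Σ (A ⇒ A) λ e₁ → Σ (B ⇒ B) λ e₂ →
    IsDaggerIdempotent 𝕏 e₁ × DaggerSplits 𝕏 e₁ ×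
    IsDaggerIdempotent 𝕏 e₂ × DaggerSplits 𝕏 e₂ ×
    IsSplitIso 𝕏 e₁ e₂ f

  MPSplit⇒isDaggerSplitIso : ∀ {A B} {f : A ⇒ B} → MPSplit 𝕏 f → IsDaggerSplitIso f
  MPSplit⇒isDaggerSplitIso {f = f} (f° , mp , ff°-splits , f°f-splits) =
    f ∘ f° , f° ∘ f ,
    MPInverse⇒isDaggerIdempotent mp , ff°-splits ,
    MPInverse⇒isDaggerIdempotent (IsMPInverse-sym mp) , f°f-splits ,
    MPInverse⇒isSplitIso mp

  isDaggerSplitIso⇒MPSplit : ∀ {A B} {f : A ⇒ B} → IsDaggerSplitIso f → MPSplit 𝕏 f
  isDaggerSplitIso⇒MPSplit
    (_ , _ , e₁-idem , e₁-splits , e₂-idem , e₂-splits , f-map , g , g-map , fg , gf) =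
    g , isSplitIso⇒MPInverse e₁-idem e₂-idem f-map g-map fg gf ,
    DaggerSplits-resp-≈ fg e₁-splits , DaggerSplits-resp-≈ gf e₂-splits

mainTheorem12 : ∀ {o ℓ e : Level} (𝕏 : DaggerCategory o ℓ e) →
    let open DaggerCategory 𝕏 in
    ∀ {A B} (f : A ⇒ B) →
      MPSplit 𝕏 f ⇔
      (Σ (A ⇒ A) λ e₁ → Σ (B ⇒ B) λ e₂ →
        IsDaggerIdempotent 𝕏 e₁ × DaggerSplits 𝕏 e₁ ×
        IsDaggerIdempotent 𝕏 e₂ × DaggerSplits 𝕏 e₂ ×
        IsSplitIso 𝕏 e₁ e₂ f)
mainTheorem12 𝕏 f = mk⇔ (MPSplit⇒isDaggerSplitIso 𝕏) (isDaggerSplitIso⇒MPSplit 𝕏)
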